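{- Let $a, b \geq 2$ and let $S$ be an $a$-cap free and $b$-cup free configuration with a fixed slope labeling $s$. For $p \in S$ and $1 \le i \le a-2$ let $\alpha_i(p)$ be the maximum size of a cup that ends with the point $p$ and whose last edge has label $\leq i$ (with $\alpha_i(p) = 1$ if there is no such cup), and let $\alpha(p) = (\alpha_1(p), \dots, \alpha_{a-2}(p))$. Then: (1) for every $p \in S$, $1 \leq \alpha_1(p) \leq \alpha_2(p) \leq \cdots \leq \alpha_{a-2}(p) \leq b-1$, so $\alpha$ is a map from $S$ to $T_{a,b} = \{(x_1,\dots,x_{a-2}) \in \mathbb{N}^{a-2} : 1 \le x_1 \le \cdots \le x_{a-2} \le b-1\}$; (2) for any two points $x < y$ of $S$ with $s(xy) = i$, we have $\alpha_i(x) < \alpha_i(y)$; in particular $\alpha$ is injective.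
   Context: A configuration is a finite set $S$ with a linear order $<$, together with an arbitrary assignment, to each $3$-element subset, of "cap" or "cup". Points $x_1 < \cdots < x_m$ form an $m$-cup (resp. $m$-cap) if every consecutive triple $x_{i-1}x_ix_{i+1}$ is labeled cup (resp. cap); 1- and 2-element sets count as both. Such a cup ends with the point $x_m$ and, if $m \ge 2$, its last edge is $x_{m-1}x_m$. An edge is a pair $x<y$ of points. $S$ is $a$-cap free (resp. $b$-cup free) if it contains no $a$-cap (resp. $b$-cup). A slope labeling of an $a$-cap free configuration $S$ is an assignment of an integer $s(xy) \in \{1, \dots, a-2\}$ to every edge $xy$ such that for all $x<y<z$ in $S$, $s(xy) \leq s(yz)$ implies that $\{x,y,z\}$ is a cup. -}

module Defs where

open import Data.Nat using (ℕ; zero; suc; _≤_; _⊔_; _≤ᵇ_)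
open import Data.Bool using (Bool; true; false; _∧_; not)
open import Data.Fin as Fin using (Fin)
open import Data.Fin.Properties using (_≟_)
open import Data.List using (List; []; _∷_; _++_; map; length; allFin)
open import Data.List.Relation.Unary.Linked using (Linked)
open import Relation.Nullary.Decidable using (⌊_⌋)
open import Relation.Binary.PropositionalEquality using (_≡_; _≢_)

-- A configuration on n points: the points are Fin n with their natural
-- linear order, and `cup x y z = true` means the triple {x<y<z} is
-- labelled "cup" (false = "cap"); values on non-increasing triples are
-- irrelevant.
Labeling : ℕ → Set
Labeling n = Fin n → Fin n → Fin n → Bool

module _ {n : ℕ} (cup : Labeling n) where

  isCupᵇ : List (Fin n) → Bool
  isCupᵇ (x ∷ y ∷ z ∷ r) = cup x y z ∧ isCupᵇ (y ∷ z ∷ r)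
  isCupᵇ _ = true

  isCapᵇ : List (Fin n) → Bool
  isCapᵇ (x ∷ y ∷ z ∷ r) = not (cup x y z) ∧ isCapᵇ (y ∷ z ∷ r)
  isCapᵇ _ = true

  IsCup : ℕ → List (Fin n) → Set
  IsCup m xs = Linked Fin._<_ xs × length xs ≡ m × isCupᵇ xs ≡ true
    where open import Data.Product using (_×_)

  IsCap : ℕ → List (Fin n) → Set
  IsCap m xs = Linked Fin._<_ xs × length xs ≡ m × isCapᵇ xs ≡ true
    where open import Data.Product using (_×_)

  CapFree : ℕ → Set
  CapFree a = ∀ xs → ¬ IsCap a xs
    where open import Relation.Nullary using (¬_)

  CupFree : ℕ → Set
  CupFree b = ∀ xs → ¬ IsCup b xs
    where open import Relation.Nullary using (¬_)

  SlopeLabeling : ℕ → (Fin n → Fin n → ℕ) → Set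
  SlopeLabeling a s =
    (∀ x y → x Fin.< y → (1 ≤ s x y) × (s x y ≤ a ∸ 2)) ×
    (∀ x y z → x Fin.< y → y Fin.< z → s x y ≤ s y z → cup x y z ≡ true)
    where open import Data.Product using (_×_)
          open import Data.Nat using (_∸_)

  subs : {A : Set} → List A → List (List A)
  subs [] = [] ∷ []
  subs (x ∷ xs) = map (x ∷_) (subs xs) ++ subs xs

  endsWithLabel≤ᵇ : (Fin n → Fin n → ℕ) → ℕ → Fin n → List (Fin n) → Bool
  endsWithLabel≤ᵇ s i p (x ∷ y ∷ []) = ⌊ y ≟ p ⌋ ∧ (s x y ≤ᵇ i)
  endsWithLabel≤ᵇ s i p (x ∷ y ∷ z ∷ r) = endsWithLabel≤ᵇ s i p (y ∷ z ∷ r)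
  endsWithLabel≤ᵇ s i p _ = false

  maxLen : (List (Fin n) → Bool) → List (List (Fin n)) → ℕ
  maxLen P [] = 1
  maxLen P (xs ∷ xss) with P xs
  ... | true  = length xs ⊔ maxLen P xss
  ... | false = maxLen P xss

  α : (Fin n → Fin n → ℕ) → ℕ → Fin n → ℕ
  α s i p = maxLen (λ xs → isCupᵇ xs ∧ endsWithLabel≤ᵇ s i p xs) (subs (allFin n))

{-# OPTIONS --safe #-}
-- Raising i only admits
-- more cups, so α is monotone in i, and b-cup-freeness bounds every α_i(p) by b − 1. If x < y and
-- s(xy) = i, a cup counted by α_i(x) ends with an edge ux of label s(ux) ≤ i = s(xy), so the slope
-- condition makes uxy a cup: appending y yields a cup counted by α_i(y) that is one point longer,
-- whence α_i(x) < α_i(y) (the edge xy alone handles α_i(x) = 1). Two distinct points are thus separated by α at the label of their edge.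
module Submission where

open import Defs
open import Data.Nat using (ℕ; suc; _≤_; _<_; _∸_; s≤s; s≤s⁻¹; z≤n)
open import Data.Nat.Properties
  using (≤-refl; ≤-trans; n≤1+n; ⊔-lub; m≤m⊔n; m≤n⇒m≤o⊔n; ≤ᵇ⇒≤; ≤⇒≤ᵇ; <⇒≤pred; <⇒≱; <-cmp; <-irrefl)
open import Data.Fin as Fin using (Fin)
import Data.Fin.Properties as Fin
open import Data.Bool using (Bool; true; false; _∧_)
open import Data.Bool.Properties using (∧-conicalˡ; ∧-conicalʳ; T-≡)
open import Data.Product using (_×_; _,_; proj₁; proj₂)
open import Data.Empty using (⊥-elim)
open import Data.List using (List; []; _∷_; _++_; [_]; map; length; allFin)
open import Data.List.Membership.Propositional using (_∈_)
open import Data.List.Membership.Propositional.Properties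
  using (∈-map⁺; ∈-map⁻; ∈-++⁺ˡ; ∈-++⁺ʳ; ∈-++⁻; ∈-allFin)
open import Data.List.Relation.Unary.Any using (here; there)
open import Data.List.Relation.Unary.All as All using (All; []; _∷_)
open import Data.List.Relation.Unary.AllPairs using (AllPairs; []; _∷_)
import Data.List.Relation.Unary.AllPairs.Properties as AllPairs
open import Data.List.Relation.Unary.Linked as Linked using (Linked; []; [-]; _∷_)
open import Data.List.Relation.Unary.Linked.Properties using (AllPairs⇒Linked; Linked⇒AllPairs)
open import Data.List.Relation.Binary.Sublist.Propositional using (_⊆_; []; _∷_; _∷ʳ_; minimum)
open import Data.List.Relation.Binary.Sublist.Propositional.Properties using (All-resp-⊆)
open import Data.Sum using (inj₁; inj₂)
open import Function using (_∘_; Equivalence)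
open import Relation.Binary.Core using (Rel)
open import Relation.Binary.Definitions using (Irreflexive; Transitive; tri<; tri≈; tri>)
open import Relation.Nullary.Decidable using (⌊_⌋; toWitness; fromWitness)
open import Relation.Binary.PropositionalEquality using (_≡_; refl; sym)

∧-≡true : ∀ {a b : Bool} → a ≡ true → b ≡ true → a ∧ b ≡ true
∧-≡true refl refl = refl

length<length-∷ʳ : ∀ {A : Set} (xs : List A) {y : A} → length xs < length (xs ++ [ y ])
length<length-∷ʳ []       = s≤s z≤n
length<length-∷ʳ (x ∷ xs) = s≤s (length<length-∷ʳ xs)

AllPairs-resp-⊆ : ∀ {ℓ} {A : Set} {R : Rel A ℓ} {xs ys} → xs ⊆ ys → AllPairs R ys → AllPairs R xs
AllPairs-resp-⊆ []           []            = []
AllPairs-resp-⊆ (_ ∷ʳ xs⊆ys) (_ ∷ Rys)     = AllPairs-resp-⊆ xs⊆ys Rys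
AllPairs-resp-⊆ (refl ∷ xs⊆ys) (Ry ∷ Rys)  = All-resp-⊆ xs⊆ys Ry ∷ AllPairs-resp-⊆ xs⊆ys Rys

module _ {ℓ} {A : Set} {_<_ : Rel A ℓ} (irrefl : Irreflexive _≡_ _<_) (trans : Transitive _<_) where

  private
    ∈-tail : ∀ {y z zs} → z < y → y ∈ z ∷ zs → y ∈ zs
    ∈-tail z<y (here refl)  = ⊥-elim (irrefl refl z<y)
    ∈-tail z<y (there y∈zs) = y∈zs

  sorted-⊆ : ∀ {xs ys} → AllPairs _<_ xs → AllPairs _<_ ys → All (_∈ ys) xs → xs ⊆ ys
  sorted-⊆ {[]}              _            _            _                   = minimum _
  sorted-⊆ {x ∷ xs}          (x<xs ∷ xs<) (y<ys ∷ ys<) (here refl ∷ xs∈)   =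
    refl ∷ sorted-⊆ xs< ys< (All.zipWith (λ (x<x′ , x′∈) → ∈-tail x<x′ x′∈) (x<xs , xs∈))
  sorted-⊆ {x ∷ xs} {y ∷ ys} (x<xs ∷ xs<) (y<ys ∷ ys<) (there x∈ys ∷ xs∈) =
    y ∷ʳ sorted-⊆ (x<xs ∷ xs<) ys< (x∈ys ∷ All.zipWith (λ (x<x′ , x′∈) → ∈-tail (trans y<x x<x′) x′∈) (x<xs , xs∈))
    where
      y<x : y < x
      y<x = All.lookup y<ys x∈ys

module _ {n : ℕ} (cup : Labeling n) where

  ∈-subs⁺ : ∀ {A : Set} {xs ys : List A} → xs ⊆ ys → xs ∈ subs cup ys
  ∈-subs⁺ []                         = here refl
  ∈-subs⁺ (refl ∷ xs⊆ys)             = ∈-++⁺ˡ (∈-map⁺ _ (∈-subs⁺ xs⊆ys))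
  ∈-subs⁺ {ys = y ∷ ys} (_ ∷ʳ xs⊆ys) = ∈-++⁺ʳ (map (y ∷_) (subs cup ys)) (∈-subs⁺ xs⊆ys)

  ∈-subs⁻ : ∀ {A : Set} (ys : List A) {xs} → xs ∈ subs cup ys → xs ⊆ ys
  ∈-subs⁻ []       (here refl) = []
  ∈-subs⁻ (y ∷ ys) xs∈ with ∈-++⁻ (map (y ∷_) (subs cup ys)) xs∈
  ... | inj₁ xs∈map with ∈-map⁻ (y ∷_) xs∈map
  ...   | _ , zs∈ , refl = refl ∷ ∈-subs⁻ ys zs∈
  ∈-subs⁻ (y ∷ ys) xs∈ | inj₂ xs∈subs = y ∷ʳ ∈-subs⁻ ys xs∈subs

  candidates : List (List (Fin n))
  candidates = subs cup (allFin n)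

  candidate⇒Linked : ∀ {xs} → xs ∈ candidates → Linked Fin._<_ xs
  candidate⇒Linked xs∈ =
    AllPairs⇒Linked (AllPairs-resp-⊆ (∈-subs⁻ (allFin n) xs∈) (AllPairs.tabulate⁺-< (λ i<j → i<j)))

  Linked⇒candidate : ∀ {xs} → Linked Fin._<_ xs → xs ∈ candidates
  Linked⇒candidate {xs} sorted = ∈-subs⁺
    (sorted-⊆ Fin.<-irrefl Fin.<-trans (Linked⇒AllPairs Fin.<-trans sorted)
      (AllPairs.tabulate⁺-< (λ i<j → i<j)) (All.universal ∈-allFin xs))

  maxLen-≥1 : ∀ P xss → 1 ≤ maxLen cup P xss
  maxLen-≥1 P []         = ≤-refl
  maxLen-≥1 P (xs ∷ xss) with P xs
  ... | true  = m≤n⇒m≤o⊔n (length xs) (maxLen-≥1 P xss)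
  ... | false = maxLen-≥1 P xss

  length≤maxLen : ∀ {P xs} xss → xs ∈ xss → P xs ≡ true → length xs ≤ maxLen cup P xss
  length≤maxLen {P} (ys ∷ xss) (here refl) Pys with P ys
  length≤maxLen {P} (ys ∷ xss) (here refl) refl | true = m≤m⊔n _ _
  length≤maxLen {P} (ys ∷ xss) (there xs∈) Pxs with P ys
  ... | true  = m≤n⇒m≤o⊔n (length ys) (length≤maxLen xss xs∈ Pxs)
  ... | false = length≤maxLen xss xs∈ Pxs

  maxLen< : ∀ {P M} xss → 1 < M → (∀ {xs} → xs ∈ xss → P xs ≡ true → length xs < M) → maxLen cup P xss < M
  maxLen< []               1<M short = 1<M
  maxLen< {P} (xs ∷ xss) 1<M short with P xs in Pxs
  ... | true  = ⊔-lub (short (here refl) Pxs) (maxLen< xss 1<M (short ∘ there))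
  ... | false = maxLen< xss 1<M (short ∘ there)

  maxLen-mono : ∀ {P Q} xss → (∀ xs → P xs ≡ true → Q xs ≡ true) → maxLen cup P xss ≤ maxLen cup Q xss
  maxLen-mono {Q = Q} xss P⇒Q = s≤s⁻¹ (maxLen< xss (s≤s (maxLen-≥1 Q xss))
    (λ {xs} xs∈ Pxs → s≤s (length≤maxLen xss xs∈ (P⇒Q xs Pxs))))

  isCupᵇ-tail : ∀ {x} xs → isCupᵇ cup (x ∷ xs) ≡ true → isCupᵇ cup xs ≡ true
  isCupᵇ-tail     []          _  = refl
  isCupᵇ-tail     (y ∷ [])    _  = refl
  isCupᵇ-tail {x} (y ∷ z ∷ r) xs = ∧-conicalʳ (cup x y z) _ xs

  -- A cup of length > b would have a suffix of length exactly b, which is again a cup.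
  cup-length< : ∀ {b} → CupFree cup b → ∀ xs → Linked Fin._<_ xs → isCupᵇ cup xs ≡ true → length xs < b
  cup-length< {b} free xs sorted isCup with <-cmp (length xs) b
  ... | tri< short _ _ = short
  ... | tri≈ _ b-cup _ = ⊥-elim (free xs (sorted , b-cup , isCup))
  cup-length< free []       _      _     | tri> _ _ ()
  cup-length< free (x ∷ xs) sorted isCup | tri> _ _ long =
    ⊥-elim (<⇒≱ (cup-length< free xs (Linked.tail sorted) (isCupᵇ-tail xs isCup)) (s≤s⁻¹ long))

module _ {n : ℕ} (cup : Labeling n) (s : Fin n → Fin n → ℕ) where

  SlopeCondition : Set
  SlopeCondition = ∀ x y z → x Fin.< y → y Fin.< z → s x y ≤ s y z → cup x y z ≡ true

  -- `α cup s i p` is definitionally `maxLen cup (cupEndingAt≤ᵇ i p) (candidates cup)`.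
  cupEndingAt≤ᵇ : ℕ → Fin n → List (Fin n) → Bool
  cupEndingAt≤ᵇ i p xs = isCupᵇ cup xs ∧ endsWithLabel≤ᵇ cup s i p xs

  endsWithLabel≤ᵇ-pair⁻ : ∀ {i p u v} → endsWithLabel≤ᵇ cup s i p (u ∷ v ∷ []) ≡ true → v ≡ p × s u v ≤ i
  endsWithLabel≤ᵇ-pair⁻ {i} {p} {u} {v} ends =
      toWitness (Equivalence.from T-≡ (∧-conicalˡ ⌊ v Fin.≟ p ⌋ _ ends))
    , ≤ᵇ⇒≤ (s u v) i (Equivalence.from T-≡ (∧-conicalʳ ⌊ v Fin.≟ p ⌋ _ ends))

  endsWithLabel≤ᵇ-pair⁺ : ∀ {i p u} → s u p ≤ i → endsWithLabel≤ᵇ cup s i p (u ∷ p ∷ []) ≡ true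
  endsWithLabel≤ᵇ-pair⁺ sup≤i = ∧-≡true (Equivalence.to T-≡ (fromWitness refl)) (Equivalence.to T-≡ (≤⇒≤ᵇ sup≤i))

  endsWithLabel≤ᵇ-suc : ∀ {i p} xs → endsWithLabel≤ᵇ cup s i p xs ≡ true → endsWithLabel≤ᵇ cup s (suc i) p xs ≡ true
  endsWithLabel≤ᵇ-suc []               ()
  endsWithLabel≤ᵇ-suc (u ∷ [])         ()
  endsWithLabel≤ᵇ-suc (u ∷ v ∷ [])     ends with endsWithLabel≤ᵇ-pair⁻ ends
  ... | refl , suv≤i = endsWithLabel≤ᵇ-pair⁺ (≤-trans suv≤i (n≤1+n _))
  endsWithLabel≤ᵇ-suc (u ∷ v ∷ w ∷ xs) ends = endsWithLabel≤ᵇ-suc (v ∷ w ∷ xs) ends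

  cup-∷ʳ : SlopeCondition → ∀ {i x y} xs →
           Linked Fin._<_ xs → isCupᵇ cup xs ≡ true → endsWithLabel≤ᵇ cup s i x xs ≡ true →
           x Fin.< y → i ≤ s x y →
           Linked Fin._<_ (xs ++ [ y ]) × isCupᵇ cup (xs ++ [ y ]) ≡ true ×
           endsWithLabel≤ᵇ cup s (s x y) y (xs ++ [ y ]) ≡ true
  cup-∷ʳ slope []           _               _     ()
  cup-∷ʳ slope (u ∷ [])     _               _     ()
  cup-∷ʳ slope (u ∷ v ∷ []) (u<v ∷ [-])     _     ends x<y i≤sxy with endsWithLabel≤ᵇ-pair⁻ ends
  ... | refl , suv≤i =
    u<v ∷ x<y ∷ [-] , ∧-≡true (slope u v _ u<v x<y (≤-trans suv≤i i≤sxy)) refl , endsWithLabel≤ᵇ-pair⁺ ≤-refl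
  cup-∷ʳ slope (u ∷ v ∷ w ∷ xs) (u<v ∷ sorted) isCup ends x<y i≤sxy
    with cup-∷ʳ slope (v ∷ w ∷ xs) sorted (isCupᵇ-tail cup (v ∷ w ∷ xs) isCup) ends x<y i≤sxy
  ... | sorted′ , isCup′ , ends′ = u<v ∷ sorted′ , ∧-≡true (∧-conicalˡ (cup u v w) _ isCup) isCup′ , ends′

  α≥1 : ∀ i p → 1 ≤ α cup s i p
  α≥1 i p = maxLen-≥1 cup (cupEndingAt≤ᵇ i p) (candidates cup)

  α< : ∀ {b} → CupFree cup b → 1 < b → ∀ i p → α cup s i p < b
  α< free 1<b i p = maxLen< cup (candidates cup) 1<b
    λ {xs} xs∈ c → cup-length< cup free xs (candidate⇒Linked cup xs∈) (∧-conicalˡ _ _ c)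

  α-mono-suc : ∀ i p → α cup s i p ≤ α cup s (suc i) p
  α-mono-suc i p = maxLen-mono cup (candidates cup)
    λ xs c → ∧-≡true (∧-conicalˡ _ _ c) (endsWithLabel≤ᵇ-suc xs (∧-conicalʳ (isCupᵇ cup xs) _ c))

  α-increasing : SlopeCondition → ∀ {x y} → x Fin.< y → α cup s (s x y) x < α cup s (s x y) y
  α-increasing slope {x} {y} x<y = maxLen< cup (candidates cup) edge extend
    where
      edge : 1 < α cup s (s x y) y
      edge = length≤maxLen cup (candidates cup) (Linked⇒candidate cup (x<y ∷ [-])) (endsWithLabel≤ᵇ-pair⁺ ≤-refl)

      extend : ∀ {xs} → xs ∈ candidates cup → cupEndingAt≤ᵇ (s x y) x xs ≡ true → length xs < α cup s (s x y) y
      extend {xs} xs∈ c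
        with cup-∷ʳ slope xs (candidate⇒Linked cup xs∈) (∧-conicalˡ _ _ c) (∧-conicalʳ (isCupᵇ cup xs) _ c) x<y ≤-refl
      ... | sorted , isCup , ends = ≤-trans (length<length-∷ʳ xs)
        (length≤maxLen cup (candidates cup) (Linked⇒candidate cup sorted) (∧-≡true isCup ends))

  α-injective : ∀ {a} → SlopeLabeling cup a s → ∀ {x y} →
                (∀ i → 1 ≤ i → i ≤ a ∸ 2 → α cup s i x ≡ α cup s i y) → x ≡ y
  α-injective (range , slope) {x} {y} same with Fin.<-cmp x y
  ... | tri≈ _ x≡y _ = x≡y
  ... | tri< x<y _ _ = ⊥-elim (<-irrefl (same (s x y) (proj₁ (range x y x<y)) (proj₂ (range x y x<y))) (α-increasing slope x<y))
  ... | tri> _ _ y<x = ⊥-elim (<-irrefl (sym (same (s y x) (proj₁ (range y x y<x)) (proj₂ (range y x y<x)))) (α-increasing slope y<x))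

theorem3p6 : (a b : ℕ) → 2 ≤ a → 2 ≤ b →
    (n : ℕ) (cup : Labeling n) → CapFree cup a → CupFree cup b →
    (s : Fin n → Fin n → ℕ) → SlopeLabeling cup a s →
    ((p : Fin n) (i : ℕ) → 1 ≤ i → i ≤ a ∸ 2 →
        (1 ≤ α cup s i p) × (α cup s i p ≤ b ∸ 1) ×
        (i < a ∸ 2 → α cup s i p ≤ α cup s (suc i) p))
    × ((x y : Fin n) → x Fin.< y → α cup s (s x y) x < α cup s (s x y) y)
    × ((x y : Fin n) → ((i : ℕ) → 1 ≤ i → i ≤ a ∸ 2 → α cup s i x ≡ α cup s i y) → x ≡ y)
theorem3p6 a b _ 2≤b n cup _ cupFree s slopeLabeling =
    (λ p i _ _ → α≥1 cup s i p , <⇒≤pred (α< cup s cupFree 2≤b i p) , λ _ → α-mono-suc cup s i p)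
  , (λ x y → α-increasing cup s (proj₂ slopeLabeling))
  , (λ x y → α-injective cup s {a} slopeLabeling)
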